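{- If $G$ is a $(4,7)$-biregular graph, then $G$ is cyclically interval colorable and $w_c(G)\leq 8$.
   Context: All graphs are finite and undirected; multiple edges are allowed, loops are not. An $(a,b)$-biregular graph is a bipartite graph with a bipartition in which all vertices of one part have degree $a$ and all vertices of the other part have degree $b$. A proper $t$-edge coloring of $G$ is a map $\alpha:E(G)\to\{1,\dots,t\}$ with $\alpha(e)\neq\alpha(e')$ for adjacent edges $e,e'$; $S(v,\alpha)$ is the set of colors on edges incident to $v$. A proper $t$-edge coloring $\alpha$ is a cyclic interval $t$-coloring if for every vertex $v$, either $S(v,\alpha)$ or $\{1,\dots,t\}\setminus S(v,\alpha)$ is a set of consecutive integers. A graph is cyclically interval colorable if it has a cyclic interval $t$-coloring for some positive integer $t$, and then $w_c(G)$ denotes the least such $t$. -}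

module Defs where

open import Data.Nat using (ℕ; _≤_)
open import Data.Fin using (Fin; _≟_)
open import Data.Bool using (Bool; true; false)
open import Data.List using (List; length; filter)
open import Data.List.Base using (allFin)
open import Data.Product using (Σ; _×_; ∃; ∃-syntax)
open import Data.Sum using (_⊎_)
open import Relation.Nullary using (¬_; Dec)
open import Relation.Nullary.Decidable using (_⊎-dec_)
open import Relation.Binary.PropositionalEquality using (_≡_; _≢_)
open import Function.Bundles using (_⇔_)

record Graph : Set where
  field
    n      : ℕ
    m      : ℕ
    end₁   : Fin m → Fin n
    end₂   : Fin m → Fin n
    noLoop : ∀ e → end₁ e ≢ end₂ e

module _ (G : Graph) where
  open Graph G

  Incident : Fin m → Fin n → Set
  Incident e v = end₁ e ≡ v ⊎ end₂ e ≡ v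

  incident? : ∀ e v → Dec (Incident e v)
  incident? e v = (end₁ e ≟ v) ⊎-dec (end₂ e ≟ v)

  degree : Fin n → ℕ
  degree v = length (filter (λ e → incident? e v) (allFin m))

  Adjacent : Fin m → Fin m → Set
  Adjacent e e' = e ≢ e' × ∃[ v ] (Incident e v × Incident e' v)

  Biregular : ℕ → ℕ → Set
  Biregular a b = Σ (Fin n → Bool) λ side →
      (∀ e → side (end₁ e) ≢ side (end₂ e))
    × (∀ v → side v ≡ false → degree v ≡ a)
    × (∀ v → side v ≡ true  → degree v ≡ b)

  ProperColoring : ℕ → (Fin m → ℕ) → Set
  ProperColoring t α =
      (∀ e → 1 ≤ α e × α e ≤ t)
    × (∀ e e' → Adjacent e e' → α e ≢ α e')

  InS : (Fin m → ℕ) → Fin n → ℕ → Set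
  InS α v c = ∃[ e ] (Incident e v × α e ≡ c)

-- a set of naturals (given as a predicate) is a set of consecutive integers
-- (the empty set counts as an interval, taking lo > hi)
Consecutive : (ℕ → Set) → Set
Consecutive P = Σ ℕ λ lo → Σ ℕ λ hi → ∀ c → P c ⇔ (lo ≤ c × c ≤ hi)

module _ (G : Graph) where
  open Graph G

  CyclicIntervalColoring : ℕ → (Fin m → ℕ) → Set
  CyclicIntervalColoring t α =
      ProperColoring G t α
    × (∀ v → Consecutive (InS G α v)
           ⊎ Consecutive (λ c → (1 ≤ c × c ≤ t) × ¬ InS G α v c))

  HasCyclicIntervalColoring : ℕ → Set
  HasCyclicIntervalColoring t = Σ (Fin m → ℕ) (CyclicIntervalColoring t)

-- An equitable 2-edge-colouring of a bipartite multigraph, in which the two colour classes at every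
-- vertex differ in size by at most one, always exists: colour an edge by its direction in an
-- orientation whose in- and out-degrees differ by at most one, and such an orientation is obtained
-- by splitting off two edges at a common vertex and recursing.
--
-- Colour G equitably three times, each time refining the vertices by the colours found so far.
-- The first colouring c₁ splits the four edges at a 4-vertex u into two pairs and leaves at most
-- four edges of each c₁-colour at a 7-vertex w. The second, c₂, on the graph with vertices
-- (u , c₁) and (w , c₁), separates the two edges of each pair at u and leaves at most two edges of
-- each (c₁ , c₂)-class at w. The third, c₃, on the graph joining (u , c₁) to (w , c₁ , c₂), takes
-- different values on the two edges of a pair at u and on the two edges of a class at w, so the
-- shift c₃ xor c₂ is constant on each pair at u and separates each class at w. The colour
-- 1 + 4 · shift + 2 · (not c₁) + (not c₂) is then proper, a 4-vertex sees one of {1,2}, {5,6}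
-- together with one of {3,4}, {7,8}, which is a cyclic interval, and a 7-vertex sees seven
-- distinct colours out of eight.
module Submission where

open import Defs
open import Data.Bool using (Bool; true; false; not; _∧_; _xor_; if_then_else_)
open import Data.Bool.Properties
  using (not-involutive; not-injective; ¬-not; xor-identityʳ; ∧-identityʳ; ∧-zeroʳ)
open import Data.Fin using (Fin)
open import Data.List using (List; []; _∷_; map; filter; length; applyUpTo; allFin)
open import Data.List.Properties using (map-cong)
open import Data.List.Membership.Propositional using (_∈_; find; lose)
open import Data.List.Membership.Propositional.Properties using (∈-applyUpTo⁺; ∈-applyUpTo⁻; ∈-allFin)
open import Data.List.Relation.Unary.All as All using (All; _∷_; all?)
open import Data.List.Relation.Unary.Any using (here; there; any?)
open import Data.List.Relation.Unary.Unique.Propositional using (Unique; _∷_)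
open import Data.List.Relation.Unary.Unique.Propositional.Properties using (applyUpTo⁺₁; allFin⁺)
open import Data.Nat using (ℕ; suc; _+_; _*_; _≤_; _<_; _≤?_; z≤n; s≤s)
open import Data.Nat.ListAction using (sum)
open import Data.Nat.Properties hiding (_≟_)
open import Data.Nat.Tactic.RingSolver using (solve-∀)
open import Data.Product using (Σ; ∃; ∃₂; _×_; _,_; proj₁; proj₂)
open import Data.Sum using (_⊎_; inj₁; inj₂)
open import Function using (_∘_; _⇔_; mk⇔)
open import Function.Bundles using (module Equivalence)
open import Relation.Binary.PropositionalEquality
open import Relation.Binary.Structures using (IsDecEquivalence)
open import Relation.Binary.TypeClasses using (_≟_)
open import Relation.Nullary using (¬_; Dec; does; yes; no; contradiction)
open import Relation.Nullary.Decidable using (True; toWitness; map′; _×-dec_; _→-dec_; ¬?)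
open import Relation.Unary using (Decidable)

open import Data.Bool.Instances
open import Data.Fin.Instances
open import Data.Nat.Instances
open import Data.Product.Instances
open import Data.Sum.Instances

open Equivalence using (to; from)

DecEq : Set → Set
DecEq A = IsDecEquivalence {A = A} _≡_

_==_ : {A : Set} {{_ : DecEq A}} → A → A → Bool
x == y = does (x ≟ y)

module _ {A : Set} {{_ : DecEq A}} where

  ==⇒≡ : {x y : A} → (x == y) ≡ true → x ≡ y
  ==⇒≡ {x} {y} eq with x ≟ y
  ==⇒≡ _  | yes x≡y = x≡y
  ==⇒≡ () | no _

  ≡⇒== : {x y : A} → x ≡ y → (x == y) ≡ true
  ≡⇒== {x} refl with x ≟ x
  ... | yes _  = refl
  ... | no x≢x = contradiction refl x≢x

  ≢⇒== : {x y : A} → x ≢ y → (x == y) ≡ false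
  ≢⇒== {x} {y} x≢y with x ≟ y
  ... | yes x≡y = contradiction x≡y x≢y
  ... | no _    = refl

module _ {A B : Set} {{_ : DecEq A}} {{_ : DecEq B}} where

  ==-, : (a c : A) (b d : B) → ((a , b) == (c , d)) ≡ (a == c) ∧ (b == d)
  ==-, a c b d with a ≟ c
  ... | yes refl = refl
  ... | no _     = refl

  ==-inj₁ : ∀ (x y : A) → (inj₁ {B = B} x == inj₁ y) ≡ (x == y)
  ==-inj₁ x y with x ≟ y
  ... | yes refl = refl
  ... | no _     = refl

  ==-inj₂ : ∀ (x y : B) → (inj₂ {A = A} x == inj₂ y) ≡ (x == y)
  ==-inj₂ x y with x ≟ y
  ... | yes refl = refl
  ... | no _     = refl

does-≡ : ∀ {P : Set} (P? : Dec P) {b} → (P → b ≡ true) → (¬ P → b ≡ false) → does P? ≡ b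
does-≡ (yes p)  yes⇒ _   = sym (yes⇒ p)
does-≡ (no ¬p) _    no⇒ = sym (no⇒ ¬p)

bit : Bool → ℕ
bit b = if b then 1 else 0

bit≤1 : ∀ b → bit b ≤ 1
bit≤1 true  = s≤s z≤n
bit≤1 false = z≤n

module _ {A : Set} where

  count : (A → Bool) → List A → ℕ
  count p xs = sum (map (bit ∘ p) xs)

  count-cong : ∀ {p q} xs → (∀ {x} → x ∈ xs → p x ≡ q x) → count p xs ≡ count q xs
  count-cong []       _  = refl
  count-cong (x ∷ xs) eq = cong₂ _+_ (cong bit (eq (here refl))) (count-cong xs (eq ∘ there))

  count-none : ∀ {p} xs → (∀ {x} → x ∈ xs → p x ≡ false) → count p xs ≡ 0
  count-none []       _    = refl
  count-none (x ∷ xs) none rewrite none (here refl) = count-none xs (none ∘ there)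

  sum-map-+ : ∀ (f g : A → ℕ) xs → sum (map (λ x → f x + g x) xs) ≡ sum (map f xs) + sum (map g xs)
  sum-map-+ f g []       = refl
  sum-map-+ f g (x ∷ xs) =
    trans (cong (f x + g x +_) (sum-map-+ f g xs)) (interchange (f x) (g x) (sum (map f xs)) (sum (map g xs)))
    where
    interchange : ∀ a b c d → (a + b) + (c + d) ≡ (a + c) + (b + d)
    interchange = solve-∀

  count-+ : ∀ {p q r} → (∀ x → bit (p x) ≡ bit (q x) + bit (r x)) →
            ∀ xs → count p xs ≡ count q xs + count r xs
  count-+ {p} {q} {r} pt xs =
    trans (cong sum (map-cong pt xs)) (sum-map-+ (bit ∘ q) (bit ∘ r) xs)

  length-filter : ∀ {P : A → Set} (P? : Decidable P) xs → length (filter P? xs) ≡ count (does ∘ P?) xs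
  length-filter P? []       = refl
  length-filter P? (x ∷ xs) with does (P? x)
  ... | true  = cong suc (length-filter P? xs)
  ... | false = length-filter P? xs

  ∈⇒1≤count : ∀ {p x} xs → x ∈ xs → p x ≡ true → 1 ≤ count p xs
  ∈⇒1≤count (y ∷ xs) (here refl) px rewrite px = s≤s z≤n
  ∈⇒1≤count {p} (y ∷ xs) (there x∈) px = ≤-trans (∈⇒1≤count xs x∈ px) (m≤n+m _ (bit (p y)))

  1≤count⇒∈ : ∀ {p} xs → 1 ≤ count p xs → ∃ λ x → x ∈ xs × p x ≡ true
  1≤count⇒∈ {p} (x ∷ xs) pos with p x in px
  ... | true  = x , here refl , px
  ... | false = let y , y∈ , py = 1≤count⇒∈ xs pos in y , there y∈ , py

  count≤1⇒injective : ∀ {p x y} xs → count p xs ≤ 1 → x ∈ xs → y ∈ xs →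
                      p x ≡ true → p y ≡ true → x ≡ y
  count≤1⇒injective (z ∷ xs) _ (here refl) (here refl) _ _ = refl
  count≤1⇒injective (z ∷ xs) c≤1 (here refl) (there y∈) px py rewrite px =
    contradiction (∈⇒1≤count xs y∈ py) (λ 1≤c → 1+n≰n (≤-trans (s≤s 1≤c) c≤1))
  count≤1⇒injective (z ∷ xs) c≤1 (there x∈) (here refl) px py rewrite py =
    contradiction (∈⇒1≤count xs x∈ px) (λ 1≤c → 1+n≰n (≤-trans (s≤s 1≤c) c≤1))
  count≤1⇒injective {p} (z ∷ xs) c≤1 (there x∈) (there y∈) px py =
    count≤1⇒injective xs (≤-trans (m≤n+m _ (bit (p z))) c≤1) x∈ y∈ px py

  injective⇒count≤1 : ∀ {p} xs → Unique xs →
                      (∀ {x y} → x ∈ xs → y ∈ xs → p x ≡ true → p y ≡ true → x ≡ y) →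
                      count p xs ≤ 1
  injective⇒count≤1 []       _            _   = z≤n
  injective⇒count≤1 {p} (x ∷ xs) (x∉ ∷ unique) inj with p x in px
  ... | true  = ≤-reflexive (cong suc (count-none xs λ y∈ →
                  ¬-not λ py → All.lookup x∉ y∈ (inj (here refl) (there y∈) px py)))
  ... | false = injective⇒count≤1 xs unique λ x∈ y∈ → inj (there x∈) (there y∈)

  count-differAt : ∀ {p q y} xs → Unique xs → y ∈ xs → (∀ {x} → x ∈ xs → x ≢ y → p x ≡ q x) →
                 count p xs + bit (q y) ≡ count q xs + bit (p y)
  count-differAt {p} {q} (x ∷ xs) (x∉ ∷ _) (here refl) agree =
    begin
      (bit (p x) + count p xs) + bit (q x) ≡⟨ cong (λ c → (bit (p x) + c) + bit (q x)) rest ⟩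
      (bit (p x) + count q xs) + bit (q x) ≡⟨ ab+c≡cb+a (bit (p x)) _ _ ⟩
      (bit (q x) + count q xs) + bit (p x) ∎
    where
    open ≡-Reasoning
    rest : count p xs ≡ count q xs
    rest = count-cong xs λ x'∈ → agree (there x'∈) λ x'≡x → All.lookup x∉ x'∈ (sym x'≡x)
    ab+c≡cb+a : ∀ a b c → (a + b) + c ≡ (c + b) + a
    ab+c≡cb+a = solve-∀
  count-differAt {p} {q} {y} (x ∷ xs) (x∉ ∷ unique) (there y∈) agree =
    begin
      (bit (p x) + count p xs) + bit (q y) ≡⟨ +-assoc (bit (p x)) _ _ ⟩
      bit (p x) + (count p xs + bit (q y))
        ≡⟨ cong₂ _+_ (cong bit px≡qx) (count-differAt xs unique y∈ (agree ∘ there)) ⟩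
      bit (q x) + (count q xs + bit (p y)) ≡⟨ sym (+-assoc (bit (q x)) _ _) ⟩
      (bit (q x) + count q xs) + bit (p y) ∎
    where
    open ≡-Reasoning
    px≡qx : p x ≡ q x
    px≡qx = agree (here refl) λ x≡y → All.lookup x∉ y∈ x≡y

  sum≤length : ∀ (f : A → ℕ) xs → (∀ x → f x ≤ 1) → sum (map f xs) ≤ length xs
  sum≤length f []       _   = z≤n
  sum≤length f (x ∷ xs) ≤1 = +-mono-≤ (≤1 x) (sum≤length f xs ≤1)

  sum≡length⇒1≤ : ∀ (f : A → ℕ) xs → (∀ x → f x ≤ 1) → sum (map f xs) ≡ length xs →
            ∀ {x} → x ∈ xs → 1 ≤ f x
  sum≡length⇒1≤ f (y ∷ xs) ≤1 full x∈ with n≤1⇒n≡0∨n≡1 (≤1 y)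
  ... | inj₁ fy≡0 = contradiction (subst (_≤ length xs) sum≡1+length (sum≤length f xs ≤1)) 1+n≰n
    where
    sum≡1+length : sum (map f xs) ≡ suc (length xs)
    sum≡1+length = trans (cong (_+ sum (map f xs)) (sym fy≡0)) full
  sum≡length⇒1≤ f (y ∷ xs) ≤1 full (here refl)  | inj₂ fy≡1 = ≤-reflexive (sym fy≡1)
  sum≡length⇒1≤ f (y ∷ xs) ≤1 full (there x∈) | inj₂ fy≡1 =
    sum≡length⇒1≤ f xs ≤1 (suc-injective (trans (cong (_+ sum (map f xs)) (sym fy≡1)) full)) x∈

  one-short⇒unique-zero : ∀ (f : A → ℕ) xs → (∀ x → f x ≤ 1) → suc (sum (map f xs)) ≡ length xs →
                          ∃ λ x₀ → x₀ ∈ xs × f x₀ ≡ 0 × ∀ {x} → x ∈ xs → x ≢ x₀ → 1 ≤ f x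
  one-short⇒unique-zero f (y ∷ xs) ≤1 almost = by-head (n≤1⇒n≡0∨n≡1 (≤1 y))
    where
    tail≡ : ∀ {k} → f y ≡ k → k + sum (map f xs) ≡ length xs
    tail≡ fy≡k = suc-injective (trans (cong (λ a → suc (a + sum (map f xs))) (sym fy≡k)) almost)
    by-head : f y ≡ 0 ⊎ f y ≡ 1 →
              ∃ λ x₀ → x₀ ∈ y ∷ xs × f x₀ ≡ 0 × ∀ {x} → x ∈ y ∷ xs → x ≢ x₀ → 1 ≤ f x
    by-head (inj₁ fy≡0) = y , here refl , fy≡0 , λ where
      (here refl) y≢y → contradiction refl y≢y
      (there x∈)  _   → sum≡length⇒1≤ f xs ≤1 (tail≡ fy≡0) x∈
    by-head (inj₂ fy≡1) =
      let x₀ , x₀∈ , fx₀≡0 , hit = one-short⇒unique-zero f xs ≤1 (tail≡ fy≡1)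
      in x₀ , there x₀∈ , fx₀≡0 , λ where
        (here refl) _ → ≤-reflexive (sym fy≡1)
        (there x∈)    → hit x∈

module _ {A : Set} {{_ : DecEq A}} where

  count-==-unique : ∀ {x : A} xs → Unique xs → x ∈ xs → count (x ==_) xs ≡ 1
  count-==-unique {x} (y ∷ xs) (y∉ ∷ _) (here refl) rewrite ≡⇒== (refl {x = x}) =
    cong suc (count-none {p = x ==_} xs λ x'∈ → ≢⇒== (All.lookup y∉ x'∈))
  count-==-unique {x} (y ∷ xs) (y∉ ∷ unique) (there x∈) rewrite ≢⇒== (λ x≡y → All.lookup y∉ x∈ (sym x≡y)) =
    count-==-unique xs unique x∈

Near : ℕ → ℕ → Set
Near a b = a ≤ suc b × b ≤ suc a

Near-sym : ∀ {a b} → Near a b → Near b a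
Near-sym (a≤b+1 , b≤a+1) = b≤a+1 , a≤b+1

Near-≤1 : ∀ {a b} → a ≤ 1 → b ≤ 1 → Near a b
Near-≤1 a≤1 b≤1 = ≤-trans a≤1 (s≤s z≤n) , ≤-trans b≤1 (s≤s z≤n)

Near-+ : ∀ {a b} k → Near a b → Near (a + k) (b + k)
Near-+ k (a≤b+1 , b≤a+1) = +-monoˡ-≤ k a≤b+1 , +-monoˡ-≤ k b≤a+1

Near-halves : ∀ {a b} k → Near a b → a + b ≤ k + k → a ≤ k × b ≤ k
Near-halves {a} {b} k near a+b≤ =
  half near a+b≤ , half (Near-sym near) (≤-trans (≤-reflexive (+-comm b a)) a+b≤)
  where
  half : ∀ {x y} → Near x y → x + y ≤ k + k → x ≤ k
  half {x} {y} (x≤y+1 , _) x+y≤ with x ≤? k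
  ... | yes x≤k = x≤k
  ... | no  x≰k = contradiction (≤-trans (+-mono-≤ k<x k≤y) x+y≤) (1+n≰n {k + k})
    where
    k<x : k < x
    k<x = ≰⇒> x≰k
    k≤y : k ≤ y
    k≤y = ≤-pred (≤-trans k<x x≤y+1)

Near-exact : ∀ {a b} k → Near a b → a + b ≡ k + k → a ≡ k × b ≡ k
Near-exact {a} {b} k near a+b≡ =
  ≤-antisym a≤k (+-cancelʳ-≤ k k a (subst (_≤ a + k) a+b≡ (+-monoʳ-≤ a b≤k))) ,
  ≤-antisym b≤k (+-cancelˡ-≤ k k b (subst (_≤ k + b) a+b≡ (+-monoˡ-≤ b a≤k)))
  where
  a≤k : a ≤ k
  a≤k = proj₁ (Near-halves k near (≤-reflexive a+b≡))
  b≤k : b ≤ k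
  b≤k = proj₂ (Near-halves k near (≤-reflexive a+b≡))

⟨_,_⟩ : {I P Q : Set} → (I → P) → (I → Q) → I → P × Q
⟨ f , g ⟩ i = f i , g i

fibre : {I P : Set} {{_ : DecEq P}} → (I → P) → List I → P → ℕ
fibre f L p = count (λ i → f i == p) L

module _ {I P : Set} {{_ : DecEq P}} where

  fibre-split : ∀ (f : I → P) (c : I → Bool) L p →
                fibre f L p ≡ fibre ⟨ f , c ⟩ L (p , true) + fibre ⟨ f , c ⟩ L (p , false)
  fibre-split f c L p = count-+ pointwise L
    where
    bit-split : ∀ a b → bit a ≡ bit (a ∧ (b == true)) + bit (a ∧ (b == false))
    bit-split true  true  = refl
    bit-split true  false = refl
    bit-split false _     = refl
    pointwise : ∀ i → bit (f i == p) ≡ bit ((f i , c i) == (p , true)) + bit ((f i , c i) == (p , false))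
    pointwise i rewrite ==-, (f i) p (c i) true | ==-, (f i) p (c i) false = bit-split (f i == p) (c i)

  fibre≤1⇒injective : ∀ {f : I → P} {L p i j} → fibre f L p ≤ 1 → i ∈ L → j ∈ L → f i ≡ p → f j ≡ p → i ≡ j
  fibre≤1⇒injective {L = L} ≤1 i∈ j∈ fi≡p fj≡p =
    count≤1⇒injective L ≤1 i∈ j∈ (≡⇒== fi≡p) (≡⇒== fj≡p)

  1≤fibre⇒∃ : ∀ (f : I → P) L {p} → 1 ≤ fibre f L p → ∃ λ i → i ∈ L × f i ≡ p
  1≤fibre⇒∃ f L pos = let i , i∈ , fi==p = 1≤count⇒∈ L pos in i , i∈ , ==⇒≡ fi==p

  fibre-sum : ∀ {Q : Set} {{_ : DecEq Q}} (f : I → P) (g : I → Q) L p cs → Unique cs → (∀ i → g i ∈ cs) →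
              sum (map (λ q → fibre ⟨ f , g ⟩ L (p , q)) cs) ≡ fibre f L p
  fibre-sum f g []      p cs _      _  = count-none {p = λ _ → false} cs λ _ → refl
  fibre-sum f g (i ∷ L) p cs unique g∈ = begin
      sum (map (λ q → bit (⟨ f , g ⟩ i == (p , q)) + fibre ⟨ f , g ⟩ L (p , q)) cs)
    ≡⟨ sum-map-+ _ _ cs ⟩
      count (λ q → ⟨ f , g ⟩ i == (p , q)) cs + sum (map (λ q → fibre ⟨ f , g ⟩ L (p , q)) cs)
    ≡⟨ cong₂ _+_ (trans (count-cong cs λ {q} _ → ==-, (f i) p (g i) q) (at-i (f i == p)))
                 (fibre-sum f g L p cs unique g∈) ⟩
      bit (f i == p) + fibre f L p ∎
    where
    open ≡-Reasoning
    at-i : ∀ b → count (λ q → b ∧ (g i == q)) cs ≡ bit b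
    at-i true  = count-==-unique cs unique (g∈ i)
    at-i false = count-none {p = λ _ → false} cs λ _ → refl

  record Equitable (f : I → P) (c : I → Bool) (L : List I) : Set where
    constructor fibresNear
    field near : ∀ p → Near (fibre ⟨ f , c ⟩ L (p , true)) (fibre ⟨ f , c ⟩ L (p , false))

  module _ {f : I → P} {c : I → Bool} {L : List I} (equitable : Equitable f c L) where

    equitable-≤ : ∀ k {p} → fibre f L p ≤ k + k → ∀ b → fibre ⟨ f , c ⟩ L (p , b) ≤ k
    equitable-≤ k {p} ≤2k b =
      pick b (Near-halves k (Equitable.near equitable p) (subst (_≤ k + k) (fibre-split f c L p) ≤2k))
      where
      pick : ∀ b → fibre ⟨ f , c ⟩ L (p , true) ≤ k × fibre ⟨ f , c ⟩ L (p , false) ≤ k →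
             fibre ⟨ f , c ⟩ L (p , b) ≤ k
      pick true  = proj₁
      pick false = proj₂

    equitable-≡ : ∀ k {p} → fibre f L p ≡ k + k → ∀ b → fibre ⟨ f , c ⟩ L (p , b) ≡ k
    equitable-≡ k {p} ≡2k b =
      pick b (Near-exact k (Equitable.near equitable p) (trans (sym (fibre-split f c L p)) ≡2k))
      where
      pick : ∀ b → fibre ⟨ f , c ⟩ L (p , true) ≡ k × fibre ⟨ f , c ⟩ L (p , false) ≡ k →
             fibre ⟨ f , c ⟩ L (p , b) ≡ k
      pick true  = proj₁
      pick false = proj₂

+-rebalance : ∀ a b c d e f → b + e ≡ c + d → a + d ≡ e + f → a + b ≡ c + f
+-rebalance a b c d e f b+e≡c+d a+d≡e+f = +-cancelʳ-≡ e _ _ (begin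
  (a + b) + e   ≡⟨ +-assoc a b e ⟩
  a + (b + e)   ≡⟨ cong (a +_) b+e≡c+d ⟩
  a + (c + d)   ≡⟨ x+yz≡y+xz a c d ⟩
  c + (a + d)   ≡⟨ cong (c +_) a+d≡e+f ⟩
  c + (e + f)   ≡⟨ x+yz≡xz+y c e f ⟩
  (c + f) + e   ∎)
  where
  open ≡-Reasoning
  x+yz≡y+xz : ∀ x y z → x + (y + z) ≡ y + (x + z)
  x+yz≡y+xz = solve-∀
  x+yz≡xz+y : ∀ x y z → x + (y + z) ≡ (x + z) + y
  x+yz≡xz+y = solve-∀

end : {V : Set} → Bool → V × V → V
end true  = proj₁
end false = proj₂

module _ {V I : Set} {{_ : DecEq V}} {{_ : DecEq I}} where

  -- The orientation o directs edge i from end (o i) to end (not (o i)); endDegree false x is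
  -- the out-degree of x, endDegree true x its in-degree.
  endDegree : Bool → (I → V × V) → (I → Bool) → List I → V → ℕ
  endDegree k ends o L x = count (λ i → end (k xor o i) (ends i) == x) L

  Balanced : (I → V × V) → (I → Bool) → List I → Set
  Balanced ends o L = ∀ x → Near (endDegree false ends o L x) (endDegree true ends o L x)

  Touches : (I → V × V) → V → I → Set
  Touches ends v i = ∃ λ s → end s (ends i) ≡ v

  touches? : ∀ ends v → Decidable (Touches ends v)
  touches? ends v i with end true (ends i) ≟ v | end false (ends i) ≟ v
  ... | yes p | _     = yes (true , p)
  ... | no _  | yes q = yes (false , q)
  ... | no p  | no q  = no λ { (true , r) → p r ; (false , r) → q r }

  -- Splitting off: replace e = a—v and e2 = v—b by one edge a—b, orient the smaller graph,
  -- and route a → v → b (or back) along the orientation of a—b.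
  splitOff : ∀ ends e rest → All (e ≢_) rest → Unique rest →
             ∀ se {e2} → e2 ∈ rest → ∀ s2 → end s2 (ends e2) ≡ end se (ends e) →
             (∀ ends' → Σ (I → Bool) λ o' → Balanced ends' o' rest) →
             Σ (I → Bool) λ o → Balanced ends o (e ∷ rest)
  splitOff ends e rest e∉ unique se {e2} e2∈ s2 shared orient-rest = o , balanced
    where
    v a b : V
    v = end se (ends e)
    a = end (not se) (ends e)
    b = end (not s2) (ends e2)

    ends' : I → V × V
    ends' i = if i == e2 then (a , b) else ends i

    o' : I → Bool
    o' = proj₁ (orient-rest ends')

    o : I → Bool
    o i = if i == e  then (if o' e2 then not se else se)
          else if i == e2 then (if o' e2 then s2 else not s2)
          else o' i

    e≢e2 : e ≢ e2
    e≢e2 = All.lookup e∉ e2∈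

    o-e : o e ≡ (if o' e2 then not se else se)
    o-e rewrite ≡⇒== (refl {x = e}) = refl

    o-e2 : o e2 ≡ (if o' e2 then s2 else not s2)
    o-e2 rewrite ≢⇒== (e≢e2 ∘ sym) | ≡⇒== (refl {x = e2}) = refl

    ends'-e2 : ends' e2 ≡ (a , b)
    ends'-e2 rewrite ≡⇒== (refl {x = e2}) = refl

    unchanged : ∀ {i} → i ∈ rest → i ≢ e2 → o i ≡ o' i × ends' i ≡ ends i
    unchanged i∈ i≢e2
      rewrite ≢⇒== (λ i≡e → All.lookup e∉ i∈ (sym i≡e)) | ≢⇒== i≢e2 = refl , refl

    merge : ∀ k x → bit (end (k xor o e) (ends e) == x) + bit (end (k xor o e2) (ends e2) == x)
                  ≡ bit (end (k xor o' e2) (a , b) == x) + bit (v == x)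
    merge k x rewrite o-e | o-e2 with o' e2 | k
    ... | true  | false rewrite shared = refl
    ... | true  | true  rewrite not-involutive se = +-comm (bit (v == x)) _
    ... | false | false = +-comm (bit (v == x)) _
    ... | false | true  rewrite not-involutive s2 | shared = refl

    shifted : ∀ k x → endDegree k ends o (e ∷ rest) x ≡ endDegree k ends' o' rest x + bit (v == x)
    shifted k x =
      +-rebalance (bit (atX o ends e)) (count (atX o ends) rest) (count (atX o' ends') rest)
                  (bit (atX o ends e2)) (bit (atX o' ends' e2)) (bit (v == x))
                  (count-differAt rest unique e2∈ agree)
                  (trans (merge k x) (cong (λ p → bit (end (k xor o' e2) p == x) + bit (v == x)) (sym ends'-e2)))
      where
      atX : (I → Bool) → (I → V × V) → I → Bool
      atX o ends i = end (k xor o i) (ends i) == x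
      agree : ∀ {i} → i ∈ rest → i ≢ e2 → atX o ends i ≡ atX o' ends' i
      agree i∈ i≢e2 with unchanged i∈ i≢e2
      ... | o≡o' , ends'≡ends rewrite o≡o' | ends'≡ends = refl

    balanced : Balanced ends o (e ∷ rest)
    balanced x = subst₂ Near (sym (shifted false x)) (sym (shifted true x))
                        (Near-+ (bit (v == x)) (proj₂ (orient-rest ends') x))

  isolated : ∀ ends e rest → All (e ≢_) rest →
             (∀ s {i} → i ∈ rest → ¬ Touches ends (end s (ends e)) i) →
             Σ (I → Bool) (λ o' → Balanced ends o' rest) →
             Σ (I → Bool) λ o → Balanced ends o (e ∷ rest)
  isolated ends e rest e∉ apart (o' , balanced') = o , balanced
    where
    o : I → Bool
    o i = if i == e then false else o' i

    unchanged : ∀ k x → endDegree k ends o rest x ≡ endDegree k ends o' rest x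
    unchanged k x = count-cong rest λ {i} i∈ →
      cong (λ i≟e → end (k xor (if i≟e then false else o' i)) (ends i) == x)
           (≢⇒== λ i≡e → All.lookup e∉ i∈ (sym i≡e))

    degree-e : ∀ k x → endDegree k ends o (e ∷ rest) x ≡ bit (end k (ends e) == x) + endDegree k ends o' rest x
    degree-e k x rewrite ≡⇒== (refl {x = e}) | unchanged k x | xor-identityʳ k = refl

    vanishes : ∀ s k → endDegree k ends o' rest (end s (ends e)) ≡ 0
    vanishes s k = count-none rest λ {i} i∈ → ≢⇒== λ touch → apart s i∈ (k xor o' i , touch)

    bit+0≤1 : ∀ b → bit b + 0 ≤ 1
    bit+0≤1 b = subst (_≤ 1) (sym (+-identityʳ (bit b))) (bit≤1 b)

    balanced : Balanced ends o (e ∷ rest)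
    balanced x with end true (ends e) ≟ x | end false (ends e) ≟ x
    ... | yes refl | _
      rewrite degree-e false x | degree-e true x | vanishes true false | vanishes true true =
      Near-≤1 (bit+0≤1 _) (bit+0≤1 _)
    ... | no _ | yes refl
      rewrite degree-e false x | degree-e true x | vanishes false false | vanishes false true =
      Near-≤1 (bit+0≤1 _) (bit+0≤1 _)
    ... | no ¬tail | no ¬head rewrite degree-e false x | degree-e true x | ≢⇒== ¬tail | ≢⇒== ¬head = balanced' x


  balancedOrientation : ∀ (ends : I → V × V) L → Unique L → Σ (I → Bool) λ o → Balanced ends o L
  balancedOrientation ends []         _             = (λ _ → true) , λ _ → z≤n , z≤n
  balancedOrientation ends (e ∷ rest) (e∉ ∷ unique)
    with any? (touches? ends (end true (ends e))) rest | any? (touches? ends (end false (ends e))) rest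
  ... | yes touch | _ = let _ , e2∈ , s2 , shared = find touch in
    splitOff ends e rest e∉ unique true e2∈ s2 shared λ ends' → balancedOrientation ends' rest unique
  ... | no _ | yes touch = let _ , e2∈ , s2 , shared = find touch in
    splitOff ends e rest e∉ unique false e2∈ s2 shared λ ends' → balancedOrientation ends' rest unique
  ... | no apart₁ | no apart₂ =
    isolated ends e rest e∉ apart (balancedOrientation ends rest unique)
    where
    apart : ∀ s {i} → i ∈ rest → ¬ Touches ends (end s (ends e)) i
    apart true  i∈ touch = apart₁ (lose i∈ touch)
    apart false i∈ touch = apart₂ (lose i∈ touch)

module _ {A B I : Set} {{_ : DecEq A}} {{_ : DecEq B}} {{_ : DecEq I}} where

  -- An edge is coloured true when a balanced orientation directs it from A to B.
  equitableColouring : ∀ (left : I → A) (right : I → B) L → Unique L →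
                       Σ (I → Bool) λ c → Equitable left c L × Equitable right c L
  equitableColouring left right L unique = o , atLeft , atRight
    where
    ends : I → (A ⊎ B) × (A ⊎ B)
    ends i = inj₁ (left i) , inj₂ (right i)

    oriented : Σ (I → Bool) λ o → Balanced ends o L
    oriented = balancedOrientation ends L unique

    o : I → Bool
    o = proj₁ oriented

    at-inj₁ : ∀ k a i → (end (k xor o i) (ends i) == inj₁ a) ≡ ((left i , o i) == (a , not k))
    at-inj₁ k a i rewrite ==-, (left i) a (o i) (not k) with k | o i
    ... | false | true  = trans (==-inj₁ {B = B} (left i) a) (sym (∧-identityʳ _))
    ... | false | false = sym (∧-zeroʳ _)
    ... | true  | true  = sym (∧-zeroʳ _)
    ... | true  | false = trans (==-inj₁ {B = B} (left i) a) (sym (∧-identityʳ _))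

    at-inj₂ : ∀ k b i → (end (k xor o i) (ends i) == inj₂ b) ≡ ((right i , o i) == (b , k))
    at-inj₂ k b i rewrite ==-, (right i) b (o i) k with k | o i
    ... | false | true  = sym (∧-zeroʳ _)
    ... | false | false = trans (==-inj₂ {A = A} (right i) b) (sym (∧-identityʳ _))
    ... | true  | true  = trans (==-inj₂ {A = A} (right i) b) (sym (∧-identityʳ _))
    ... | true  | false = sym (∧-zeroʳ _)

    atLeft : Equitable left o L
    atLeft = fibresNear λ a →
      subst₂ Near (count-cong L λ {i} _ → at-inj₁ false a i) (count-cong L λ {i} _ → at-inj₁ true a i)
                  (proj₂ oriented (inj₁ a))

    atRight : Equitable right o L
    atRight = fibresNear λ b → Near-sym
      (subst₂ Near (count-cong L λ {i} _ → at-inj₂ false b i) (count-cong L λ {i} _ → at-inj₂ true b i)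
                   (proj₂ oriented (inj₂ b)))

palette : List ℕ
palette = applyUpTo suc 8

∈-palette⁻ : ∀ {c} → c ∈ palette → 1 ≤ c × c ≤ 8
∈-palette⁻ c∈ with _ , i<8 , refl ← ∈-applyUpTo⁻ suc c∈ = s≤s z≤n , i<8

∈-palette⁺ : ∀ {c} → 1 ≤ c → c ≤ 8 → c ∈ palette
∈-palette⁺ {suc i} _ c≤8 = ∈-applyUpTo⁺ suc c≤8

unique-palette : Unique palette
unique-palette = applyUpTo⁺₁ suc 8 λ i<j _ → <⇒≢ i<j ∘ suc-injective

code : Bool → Bool → Bool → ℕ
code s t h = suc (bit h * 4 + bit (not s) * 2 + bit (not t))

code∈palette : ∀ s t h → code s t h ∈ palette
code∈palette s t h =
  ∈-palette⁺ (s≤s z≤n)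
    (s≤s (+-mono-≤ (+-mono-≤ (*-monoˡ-≤ 4 (bit≤1 h)) (*-monoˡ-≤ 2 (bit≤1 (not s)))) (bit≤1 (not t))))

decode : ℕ → Bool × Bool × Bool
decode 1 = true  , true  , false
decode 2 = true  , false , false
decode 3 = false , true  , false
decode 4 = false , false , false
decode 5 = true  , true  , true
decode 6 = true  , false , true
decode 7 = false , true  , true
decode _ = false , false , true

decode-code : ∀ s t h → decode (code s t h) ≡ (s , t , h)
decode-code true  true  true  = refl
decode-code true  true  false = refl
decode-code true  false true  = refl
decode-code true  false false = refl
decode-code false true  true  = refl
decode-code false true  false = refl
decode-code false false true  = refl
decode-code false false false = refl

code-injective : ∀ {s t h s' t' h'} → code s t h ≡ code s' t' h' → s ≡ s' × t ≡ t' × h ≡ h'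
code-injective {s} {t} {h} {s'} {t'} {h'} eq =
  cong proj₁ decoded , cong (proj₁ ∘ proj₂) decoded , cong (proj₂ ∘ proj₂) decoded
  where
  decoded : (s , t , h) ≡ (s' , t' , h')
  decoded = trans (sym (decode-code s t h)) (trans (cong decode eq) (decode-code s' t' h'))

CyclicInterval : ℕ → (ℕ → Set) → Set
CyclicInterval t P = Consecutive P ⊎ Consecutive (λ c → (1 ≤ c × c ≤ t) × ¬ P c)

cyclicInterval-resp : ∀ {P Q : ℕ → Set} t → (∀ c → P c ⇔ Q c) → CyclicInterval t Q → CyclicInterval t P
cyclicInterval-resp t P⇔Q (inj₁ (lo , hi , Q⇔)) =
  inj₁ (lo , hi , λ c → mk⇔ (to (Q⇔ c) ∘ to (P⇔Q c)) (from (P⇔Q c) ∘ from (Q⇔ c)))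
cyclicInterval-resp t P⇔Q (inj₂ (lo , hi , ¬Q⇔)) =
  inj₂ (lo , hi , λ c → mk⇔ (λ (r , ¬p) → to (¬Q⇔ c) (r , ¬p ∘ from (P⇔Q c)))
                            (λ range → let r , ¬q = from (¬Q⇔ c) range in r , ¬q ∘ to (P⇔Q c)))

_⇔?_ : {A B : Set} → Dec A → Dec B → Dec (A ⇔ B)
a? ⇔? b? = map′ (λ (f , g) → mk⇔ f g) (λ e → to e , from e) ((a? →-dec b?) ×-dec (b? →-dec a?))

consecutive-by-table : ∀ {P : ℕ → Set} (P? : Decidable P) lo hi → True (1 ≤? lo) → True (hi ≤? 8) →
                       (∀ {c} → P c → c ∈ palette) →
                       True (all? (λ c → P? c ⇔? ((lo ≤? c) ×-dec (c ≤? hi))) palette) →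
                       Consecutive P
consecutive-by-table {P} P? lo hi 1≤lo hi≤8 ⊆palette table =
  lo , hi , λ c → mk⇔ (λ p → to (entry (⊆palette p)) p)
                      (λ (lo≤c , c≤hi) → from (entry (∈-palette⁺ (≤-trans (toWitness 1≤lo) lo≤c)
                                                              (≤-trans c≤hi (toWitness hi≤8))))
                                                 (lo≤c , c≤hi))
  where
  entry : ∀ {c} → c ∈ palette → P c ⇔ (lo ≤ c × c ≤ hi)
  entry = All.lookup (toWitness table)

∃-Bool? : {Q : Bool → Set} → Dec (Q true) → Dec (Q false) → Dec (Σ Bool Q)
∃-Bool? (yes q)  _        = yes (true , q)
∃-Bool? (no _)   (yes q)  = yes (false , q)
∃-Bool? (no ¬q₁) (no ¬q₂) = no λ { (true , q) → ¬q₁ q ; (false , q) → ¬q₂ q }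

-- The colours at a 4-vertex whose c₁-pairs are shifted by a (c₁ = true) and b (c₁ = false).
uPalette : Bool → Bool → ℕ → Set
uPalette a b c = ∃₂ λ s t → code s t (if s then a else b) ≡ c

uPalette? : ∀ a b → Decidable (uPalette a b)
uPalette? a b c = ∃-Bool? (∃-Bool? (code true true a ≟ c) (code true false a ≟ c))
                          (∃-Bool? (code false true b ≟ c) (code false false b ≟ c))

uPalette⊆palette : ∀ {a b c} → uPalette a b c → c ∈ palette
uPalette⊆palette {a} {b} (s , t , refl) = code∈palette s t (if s then a else b)

uPalette-cyclic : ∀ a b → CyclicInterval 8 (uPalette a b)
uPalette-cyclic false false = inj₁ (consecutive-by-table (uPalette? false false) 1 4 _ _ uPalette⊆palette _)
uPalette-cyclic true  true  = inj₁ (consecutive-by-table (uPalette? true true) 5 8 _ _ uPalette⊆palette _)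
uPalette-cyclic true  false = inj₁ (consecutive-by-table (uPalette? true false) 3 6 _ _ uPalette⊆palette _)
uPalette-cyclic false true  = inj₂ (consecutive-by-table complement? 3 6 _ _ ⊆palette _)
  where
  complement? : Decidable λ c → (1 ≤ c × c ≤ 8) × ¬ uPalette false true c
  complement? c = ((1 ≤? c) ×-dec (c ≤? 8)) ×-dec ¬? (uPalette? false true c)
  ⊆palette : ∀ {c} → (1 ≤ c × c ≤ 8) × ¬ uPalette false true c → c ∈ palette
  ⊆palette ((1≤c , c≤8) , _) = ∈-palette⁺ 1≤c c≤8

module Bipartition (G : Graph) (side : Fin (Graph.n G) → Bool)
                   (bipartite : ∀ e → side (Graph.end₁ G e) ≢ side (Graph.end₂ G e)) where
  open Graph G

  endOn : Bool → Fin m → Fin n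
  endOn b e = if side (end₁ e) == b then end₁ e else end₂ e

  side-endOn : ∀ b e → side (endOn b e) ≡ b
  side-endOn b e with side (end₁ e) ≟ b
  ... | yes p  = p
  ... | no  ¬p = trans (¬-not (bipartite e ∘ sym)) (trans (cong not (¬-not ¬p)) (not-involutive b))

  endOn-incident : ∀ b e → Incident G e (endOn b e)
  endOn-incident b e with side (end₁ e) ≟ b
  ... | yes _ = inj₁ refl
  ... | no  _ = inj₂ refl

  endOn-unique : ∀ {b e v} → side v ≡ b → Incident G e v → endOn b e ≡ v
  endOn-unique {b} {e} sv incident with side (end₁ e) ≟ b | incident
  ... | yes _  | inj₁ p = p
  ... | yes p  | inj₂ q = contradiction (trans p (sym (trans (cong side q) sv))) (bipartite e)
  ... | no  ¬p | inj₁ q = contradiction (trans (cong side q) sv) ¬p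
  ... | no  _  | inj₂ q = q

  degree≡fibre : ∀ {b v} → side v ≡ b → degree G v ≡ fibre (endOn b) (allFin m) v
  degree≡fibre {b} {v} sv =
    trans (length-filter (λ e → incident? G e v) (allFin m)) (count-cong (allFin m) λ {e} _ → pointwise e)
    where
    pointwise : ∀ e → does (incident? G e v) ≡ (endOn b e == v)
    pointwise e = does-≡ (incident? G e v) (≡⇒== ∘ endOn-unique sv)
                         λ ¬incident → ≢⇒== λ eq → ¬incident (subst (Incident G e) eq (endOn-incident b e))

module Biregular47Colouring (G : Graph) (side : Fin (Graph.n G) → Bool)
                            (bipartite : ∀ e → side (Graph.end₁ G e) ≢ side (Graph.end₂ G e))
                            (degree-false : ∀ v → side v ≡ false → degree G v ≡ 4)
                            (degree-true  : ∀ v → side v ≡ true  → degree G v ≡ 7) where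
  open Graph G
  open Bipartition G side bipartite

  edges : List (Fin m)
  edges = allFin m

  uEnd wEnd : Fin m → Fin n
  uEnd = endOn false
  wEnd = endOn true

  opaque
    first : Σ (Fin m → Bool) λ c → Equitable uEnd c edges × Equitable wEnd c edges
    first = equitableColouring uEnd wEnd edges (allFin⁺ m)

  c₁ : Fin m → Bool
  c₁ = proj₁ first

  opaque
    second : Σ (Fin m → Bool) λ c → Equitable ⟨ uEnd , c₁ ⟩ c edges × Equitable ⟨ wEnd , c₁ ⟩ c edges
    second = equitableColouring ⟨ uEnd , c₁ ⟩ ⟨ wEnd , c₁ ⟩ edges (allFin⁺ m)

  c₂ : Fin m → Bool
  c₂ = proj₁ second

  opaque
    third : Σ (Fin m → Bool) λ c → Equitable ⟨ uEnd , c₁ ⟩ c edges × Equitable ⟨ ⟨ wEnd , c₁ ⟩ , c₂ ⟩ c edges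
    third = equitableColouring ⟨ uEnd , c₁ ⟩ ⟨ ⟨ wEnd , c₁ ⟩ , c₂ ⟩ edges (allFin⁺ m)

  c₃ : Fin m → Bool
  c₃ = proj₁ third

  shift : Fin m → Bool
  shift e = c₃ e xor c₂ e

  colour : Fin m → ℕ
  colour e = code (c₁ e) (c₂ e) (shift e)

  module AtU {u} (su : side u ≡ false) where

    size₁ : fibre uEnd edges u ≡ 2 + 2
    size₁ = trans (sym (degree≡fibre su)) (degree-false u su)

    size₂ : ∀ s → fibre ⟨ uEnd , c₁ ⟩ edges (u , s) ≡ 1 + 1
    size₂ = equitable-≡ (proj₁ (proj₂ first)) 2 size₁

    size₃ : ∀ s t → fibre ⟨ ⟨ uEnd , c₁ ⟩ , c₂ ⟩ edges ((u , s) , t) ≡ 1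
    size₃ s = equitable-≡ (proj₁ (proj₂ second)) 1 (size₂ s)

    size₃′ : ∀ s r → fibre ⟨ ⟨ uEnd , c₁ ⟩ , c₃ ⟩ edges ((u , s) , r) ≡ 1
    size₃′ s = equitable-≡ (proj₁ (proj₂ third)) 1 (size₂ s)

  module AtW {w} (sw : side w ≡ true) where

    size₁ : fibre wEnd edges w ≤ 4 + 4
    size₁ = ≤-trans (≤-reflexive (trans (sym (degree≡fibre sw)) (degree-true w sw))) (n≤1+n 7)

    size₂ : ∀ s → fibre ⟨ wEnd , c₁ ⟩ edges (w , s) ≤ 2 + 2
    size₂ = equitable-≤ (proj₂ (proj₂ first)) 4 size₁

    size₃ : ∀ s t → fibre ⟨ ⟨ wEnd , c₁ ⟩ , c₂ ⟩ edges ((w , s) , t) ≤ 1 + 1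
    size₃ s = equitable-≤ (proj₂ (proj₂ second)) 2 (size₂ s)

    size₄ : ∀ s t r → fibre ⟨ ⟨ ⟨ wEnd , c₁ ⟩ , c₂ ⟩ , c₃ ⟩ edges (((w , s) , t) , r) ≤ 1
    size₄ s t = equitable-≤ (proj₂ (proj₂ third)) 1 (size₃ s t)

  same-u : ∀ {e e'} → uEnd e ≡ uEnd e' → c₁ e ≡ c₁ e' → c₂ e ≡ c₂ e' → e ≡ e'
  same-u {e} {e'} pu p₁ p₂ =
    fibre≤1⇒injective (≤-reflexive (AtU.size₃ (side-endOn false e) (c₁ e) (c₂ e)))
      (∈-allFin e) (∈-allFin e') refl (sym (cong₂ _,_ (cong₂ _,_ pu p₁) p₂))

  same-u′ : ∀ {e e'} → uEnd e ≡ uEnd e' → c₁ e ≡ c₁ e' → c₃ e ≡ c₃ e' → e ≡ e'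
  same-u′ {e} {e'} pu p₁ p₃ =
    fibre≤1⇒injective (≤-reflexive (AtU.size₃′ (side-endOn false e) (c₁ e) (c₃ e)))
      (∈-allFin e) (∈-allFin e') refl (sym (cong₂ _,_ (cong₂ _,_ pu p₁) p₃))

  same-w : ∀ {e e'} → wEnd e ≡ wEnd e' → c₁ e ≡ c₁ e' → c₂ e ≡ c₂ e' → c₃ e ≡ c₃ e' → e ≡ e'
  same-w {e} {e'} pw p₁ p₂ p₃ =
    fibre≤1⇒injective (AtW.size₄ (side-endOn true e) (c₁ e) (c₂ e) (c₃ e))
      (∈-allFin e) (∈-allFin e') refl (sym (cong₂ _,_ (cong₂ _,_ (cong₂ _,_ pw p₁) p₂) p₃))

  shift-at-u : ∀ {e e'} → uEnd e ≡ uEnd e' → c₁ e ≡ c₁ e' → shift e ≡ shift e'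
  shift-at-u {e} {e'} pu p₁ with e ≟ e'
  ... | yes refl = refl
  ... | no e≢e'  rewrite ¬-not (e≢e' ∘ same-u′ pu p₁) | ¬-not (e≢e' ∘ same-u pu p₁) =
    xor-not-not (c₃ e') (c₂ e')
    where
    xor-not-not : ∀ x y → not x xor not y ≡ x xor y
    xor-not-not true  _ = refl
    xor-not-not false y = not-involutive y

  colour-injective : ∀ {e e' v} → Incident G e v → Incident G e' v → colour e ≡ colour e' → e ≡ e'
  colour-injective {e} {e'} {v} inc inc' same with code-injective same | side v in sv
  ... | p₁ , p₂ , p-shift | false =
    same-u (trans (endOn-unique sv inc) (sym (endOn-unique sv inc'))) p₁ p₂
  ... | p₁ , p₂ , p-shift | true  =
    same-w (trans (endOn-unique sv inc) (sym (endOn-unique sv inc'))) p₁ p₂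
           (xor-cancelʳ (c₂ e') (subst (λ t → c₃ e xor t ≡ c₃ e' xor c₂ e') p₂ p-shift))
    where
    xor-cancelʳ : ∀ {x x'} y → x xor y ≡ x' xor y → x ≡ x'
    xor-cancelʳ {x} {x'} false eq = trans (sym (xor-identityʳ x)) (trans eq (xor-identityʳ x'))
    xor-cancelʳ {x} {x'} true  eq = not-injective (trans (sym (xor-true x)) (trans eq (xor-true x')))
      where
      xor-true : ∀ x → x xor true ≡ not x
      xor-true true  = refl
      xor-true false = refl

  proper : ProperColoring G 8 colour
  proper = (λ e → ∈-palette⁻ (code∈palette (c₁ e) (c₂ e) (shift e))) ,
           λ e e' (e≢e' , v , inc , inc') same → e≢e' (colour-injective inc inc' same)

  module PaletteAtU {u} (su : side u ≡ false) where

    representative : ∀ s t → ∃ λ e → uEnd e ≡ u × c₁ e ≡ s × c₂ e ≡ t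
    representative s t =
      let e , _ , port≡ = 1≤fibre⇒∃ ⟨ ⟨ uEnd , c₁ ⟩ , c₂ ⟩ edges (≤-reflexive (sym (AtU.size₃ su s t)))
      in e , cong (proj₁ ∘ proj₁) port≡ , cong (proj₂ ∘ proj₁) port≡ , cong proj₂ port≡

    shift₁ shift₀ : Bool
    shift₁ = shift (proj₁ (representative true true))
    shift₀ = shift (proj₁ (representative false true))

    shift-at : ∀ {e} → uEnd e ≡ u → shift e ≡ (if c₁ e then shift₁ else shift₀)
    shift-at {e} pu = by-c₁ (c₁ e) refl
      where
      by-c₁ : ∀ b → c₁ e ≡ b → shift e ≡ (if b then shift₁ else shift₀)
      by-c₁ true  p₁ = let _ , pr , r₁ , _ = representative true true in
                       shift-at-u (trans pu (sym pr)) (trans p₁ (sym r₁))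
      by-c₁ false p₁ = let _ , pr , r₁ , _ = representative false true in
                       shift-at-u (trans pu (sym pr)) (trans p₁ (sym r₁))

    InS⇔uPalette : ∀ c → InS G colour u c ⇔ uPalette shift₁ shift₀ c
    InS⇔uPalette c = mk⇔ to′ from′
      where
      to′ : InS G colour u c → uPalette shift₁ shift₀ c
      to′ (e , inc , refl) = c₁ e , c₂ e , cong (code (c₁ e) (c₂ e)) (sym (shift-at (endOn-unique su inc)))
      from′ : uPalette shift₁ shift₀ c → InS G colour u c
      from′ (s , t , refl) =
        let e , pu , p₁ , p₂ = representative s t in
        e , subst (Incident G e) pu (endOn-incident false e) ,
        trans (cong (code (c₁ e) (c₂ e)) (shift-at pu))
              (cong₂ (λ s′ t′ → code s′ t′ (if s′ then shift₁ else shift₀)) p₁ p₂)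

  module PaletteAtW {w} (sw : side w ≡ true) where

    hits : ℕ → ℕ
    hits = fibre ⟨ wEnd , colour ⟩ edges ∘ (w ,_)

    InS⇔hit : ∀ c → InS G colour w c ⇔ 1 ≤ hits c
    InS⇔hit c = mk⇔ (λ (e , inc , col) →
                      ∈⇒1≤count edges (∈-allFin e) (≡⇒== (cong₂ _,_ (endOn-unique sw inc) col)))
                    λ hit → let e , _ , port≡ = 1≤fibre⇒∃ ⟨ wEnd , colour ⟩ edges hit in
                      e , subst (Incident G e) (cong proj₁ port≡) (endOn-incident true e) , cong proj₂ port≡

    hits≤1 : ∀ c → hits c ≤ 1
    hits≤1 c = injective⇒count≤1 edges (allFin⁺ m) λ {e} {e'} _ _ he he' →
      let port≡  = ==⇒≡ he
          port≡′ = ==⇒≡ he'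
      in colour-injective (subst (Incident G e) (cong proj₁ port≡) (endOn-incident true e))
                          (subst (Incident G e') (cong proj₁ port≡′) (endOn-incident true e'))
                          (trans (cong proj₂ port≡) (sym (cong proj₂ port≡′)))

    hits-total : sum (map hits palette) ≡ 7
    hits-total =
      trans (fibre-sum wEnd colour edges w palette unique-palette λ e → code∈palette (c₁ e) (c₂ e) (shift e))
            (trans (sym (degree≡fibre sw)) (degree-true w sw))

    cyclic : CyclicInterval 8 (InS G colour w)
    cyclic with one-short⇒unique-zero hits palette hits≤1 (cong suc hits-total)
    ... | c₀ , c₀∈ , missed , hit = inj₂ (c₀ , c₀ , λ c → mk⇔ (to′ c) (from′ c))
      where
      to′ : ∀ c → (1 ≤ c × c ≤ 8) × ¬ InS G colour w c → c₀ ≤ c × c ≤ c₀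
      to′ c ((1≤c , c≤8) , unused) with c ≟ c₀
      ... | yes refl = ≤-refl , ≤-refl
      ... | no  c≢c₀ = contradiction (from (InS⇔hit c) (hit (∈-palette⁺ 1≤c c≤8) c≢c₀)) unused
      from′ : ∀ c → c₀ ≤ c × c ≤ c₀ → (1 ≤ c × c ≤ 8) × ¬ InS G colour w c
      from′ c (c₀≤c , c≤c₀) with ≤-antisym c≤c₀ c₀≤c
      ... | refl = ∈-palette⁻ c₀∈ , λ used → contradiction (subst (1 ≤_) missed (to (InS⇔hit c₀) used)) λ ()

  cyclic : ∀ v → CyclicInterval 8 (InS G colour v)
  cyclic v with side v in sv
  ... | false = cyclicInterval-resp 8 InS⇔uPalette (uPalette-cyclic shift₁ shift₀)
    where open PaletteAtU sv
  ... | true  = PaletteAtW.cyclic sv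

corollary7 : (G : Graph) → Biregular G 4 7 →
    Σ ℕ λ t → 1 ≤ t × t ≤ 8 × HasCyclicIntervalColoring G t
corollary7 G (side , bipartite , degree-false , degree-true) =
  8 , s≤s z≤n , ≤-refl , colour , proper , cyclic
  where open Biregular47Colouring G side bipartite degree-false degree-true
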